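{- There is a constant $c>0$ such that for every graph $G$ on $n\ge 2$ vertices, there is a formula $F$ with $\bigwedge_{\{u,v\}\in E(G)}(\overline{x_u}\lor\overline{x_v}) \rightsquigarrow_{\mathsf{BVA}} F$ and $|F|\le c\,n^2/\log_2 n$.
   Context: A clause is a set of non-complementary literals and a formula is a set of clauses; $|F|$ is the number of clauses. Grid product: for a clause $L$ and a set of clauses $\Gamma$, $L\bowtie\Gamma := \{\gamma\cup\{\ell\} : \ell\in L,\ \gamma\in\Gamma\}$. One BVA step: if $F$ contains a subset of the form $L\bowtie\Gamma$, and $y$ is a new variable not occurring in $F$, then $F' := (F\setminus (L\bowtie\Gamma))\cup\{\overline{y}\lor\ell : \ell\in L\}\cup\{y\lor\gamma : \gamma\in\Gamma\}$ is obtainable from $F$ by BVA, written $F\xrightarrow{\mathsf{BVA}}F'$. We write $F\rightsquigarrow_{\mathsf{BVA}} F_k$ if there is a sequence $F\xrightarrow{\mathsf{BVA}}F_1\xrightarrow{\mathsf{BVA}}\cdots\xrightarrow{\mathsf{BVA}}F_k$. The variables $x_v$, $v\in V(G)$, are Boolean variables, one per vertex. -}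

module Defs where

open import Data.Nat using (ℕ)
open import Data.Bool using (Bool; true; false; if_then_else_)
open import Data.Fin using (Fin; toℕ)
open import Data.List using (List; []; _∷_; concatMap; allFin)
open import Data.List.Membership.Propositional using (_∈_)
open import Data.List.Relation.Unary.Any using (Any)
open import Data.List.Relation.Unary.All using (All)
open import Data.List.Relation.Unary.AllPairs using (AllPairs)
open import Data.Product using (Σ; _×_; ∃; ∃-syntax)
open import Data.Sum using (_⊎_)
open import Data.Empty using (⊥)
open import Relation.Nullary using (¬_)
open import Relation.Binary.PropositionalEquality using (_≡_)
open import Relation.Binary.Construct.Closure.ReflexiveTransitive using (Star)

data Lit : Set where
  pos : ℕ → Lit
  neg : ℕ → Lit

var : Lit → ℕ
var (pos x) = x
var (neg x) = x

-- A clause is a finite set of literals, represented by a list read as a set.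
Clause : Set
Clause = List Lit

_≈_ : Clause → Clause → Set
C ≈ D = ∀ l → (l ∈ C → l ∈ D) × (l ∈ D → l ∈ C)

NonComp : Clause → Set
NonComp C = ∀ x → ¬ (pos x ∈ C × neg x ∈ C)

-- A formula is a finite set of clauses, represented by a list read as a set
-- (clauses compared up to set equality).
Formula : Set
Formula = List Clause

_∈F_ : Clause → Formula → Set
C ∈F F = Any (λ D → C ≈ D) F

Occurs : ℕ → Formula → Set
Occurs y F = Any (λ C → Any (λ l → var l ≡ y) C) F

_∈⋈_,_ : Clause → Clause → List Clause → Set
C ∈⋈ L , Γ = ∃[ ℓ ] ∃[ γ ] (ℓ ∈ L × γ ∈ Γ × C ≈ (ℓ ∷ γ))

BVAStep : Formula → Formula → Set
BVAStep F F' =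
  ∃[ L ] ∃[ Γ ] ∃[ y ]
    ( NonComp L
    × All NonComp Γ
    × ¬ Occurs y F
    × (∀ ℓ γ → ℓ ∈ L → γ ∈ Γ → (ℓ ∷ γ) ∈F F)
    × (∀ C → (C ∈F F' → Rhs L Γ y C) × (Rhs L Γ y C → C ∈F F')) )
  where
  Rhs : Clause → List Clause → ℕ → Clause → Set
  Rhs L Γ y C =
      (C ∈F F × ¬ (C ∈⋈ L , Γ))
    ⊎ (∃[ ℓ ] (ℓ ∈ L × C ≈ (neg y ∷ ℓ ∷ [])))
    ⊎ (∃[ γ ] (γ ∈ Γ × C ≈ (pos y ∷ γ)))

_⇝BVA_ : Formula → Formula → Set
_⇝BVA_ = Star BVAStep

-- Number of clauses |F|: for a list with pairwise set-distinct clauses, its length.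
Distinct : Formula → Set
Distinct = AllPairs (λ C D → ¬ (C ≈ D))

record Graph (n : ℕ) : Set where
  field
    adj   : Fin n → Fin n → Bool
    sym   : ∀ u v → adj u v ≡ adj v u
    irrefl : ∀ v → adj v v ≡ false

edgeFormula : ∀ {n} → Graph n → Formula
edgeFormula {n} G =
  concatMap (λ u → concatMap (λ v →
     if Graph.adj G u v then (neg (toℕ u) ∷ neg (toℕ v) ∷ []) ∷ [] else [])
     (allFin n)) (allFin n)

{-# OPTIONS --safe #-}
module Submission where

-- Cut the vertices into blocks of k = ⌊log₂ n / 2⌋ + 1 consecutive vertices, so that 2^k = O(√n).
-- For a block j and a set s of vertices of block j, the vertices u of earlier blocks whose
-- neighbourhood inside block j is exactly s form a complete bipartite subgraph with s, and over all
-- (j, s) these bicliques partition the edges between different blocks. One BVA step per biclique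
-- replaces its edge clauses x̄_u ∨ x̄_v by the clauses ȳ ∨ x̄_u and y ∨ x̄_v. What is left are at most
-- nk edge clauses inside blocks, at most n clauses ȳ ∨ x̄_u per block (u lies in one biclique per
-- block) and at most k clauses y ∨ x̄_v per pair (j, s): O(nk + n²/k + (n/k) 2^k k) = O(n² / log n).

open import Defs
open import Data.Nat
  using (ℕ; zero; suc; _≤_; _<_; _*_; _+_; _^_; _∸_; _/_; _%_; _<ᵇ_; _≡ᵇ_; ⌊_/2⌋; ⌈_/2⌉;
         z≤n; s≤s; NonZero; >-nonZero⁻¹)
open import Data.Nat.Properties
open import Data.Nat.DivMod
open import Data.Nat.Induction using (<-rec)
open import Data.Nat.Logarithm
  using (⌊log₂_⌋; ⌊log₂⌋-mono-≤; ⌊log₂⌊n/2⌋⌋≡⌊log₂n⌋∸1; ⌊log₂[2^n]⌋≡n)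
open import Data.Nat.Tactic.RingSolver using (solve-∀)
open import Data.Bool using (Bool; true; false; T; not; _∧_; _∨_; if_then_else_)
open import Data.Bool.Properties using (T-∧; T-∨)
open import Data.Fin using (Fin; toℕ; fromℕ<)
open import Data.Fin.Properties using (toℕ<n; toℕ-fromℕ<; fromℕ<-toℕ)
open import Data.List using (List; []; _∷_; [_]; _++_; length; concatMap; upTo; allFin; deduplicate)
open import Data.List.Properties using (length-++; length-upTo; length-deduplicate)
open import Data.List.Membership.Propositional using (_∈_; find; lose)
open import Data.List.Membership.Propositional.Properties using (∈-upTo⁺; ∈-upTo⁻; ∈-allFin)
open import Data.List.Relation.Unary.Any using (Any; here; there)
import Data.List.Relation.Unary.Any as Any
open import Data.List.Relation.Unary.Any.Properties
  using (++⁺ˡ; ++⁺ʳ; ++⁻; concatMap⁺; concatMap⁻; deduplicate⁺; deduplicate⁻)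
open import Data.List.Relation.Unary.All using (All)
import Data.List.Relation.Unary.All as All
open import Data.List.Relation.Unary.Unique.DecSetoid.Properties using (deduplicate-!)
import Data.List.Relation.Binary.Subset.DecPropositional as Subset
open import Data.Product using (_×_; _,_; proj₁; proj₂; ∃-syntax)
open import Data.Sum using (_⊎_; inj₁; inj₂)
import Data.Sum as Sum
open import Function using (_∘_)
open import Function.Bundles using (Equivalence)
open import Relation.Nullary using (¬_; yes; no; map′; _×-dec_; contradiction)
open import Relation.Binary.Bundles using (DecSetoid)
open import Relation.Binary.Definitions using (DecidableEquality; Decidable; tri<; tri≈; tri>)
open import Relation.Binary.PropositionalEquality
  using (_≡_; refl; sym; trans; cong; cong₂; subst; module ≡-Reasoning)
open import Relation.Binary.Construct.Closure.ReflexiveTransitive using (ε; _◅_; _◅◅_)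

open Equivalence using (to; from)

≈-refl : ∀ {C} → C ≈ C
≈-refl l = (λ p → p) , (λ p → p)

≈-sym : ∀ {C D} → C ≈ D → D ≈ C
≈-sym e l = proj₂ (e l) , proj₁ (e l)

≈-trans : ∀ {C D E} → C ≈ D → D ≈ E → C ≈ E
≈-trans e f l = (λ p → proj₁ (f l) (proj₁ (e l) p)) , (λ p → proj₂ (e l) (proj₂ (f l) p))

_≟ˡ_ : DecidableEquality Lit
pos x ≟ˡ pos y = map′ (cong pos) (λ { refl → refl }) (x ≟ y)
neg x ≟ˡ neg y = map′ (cong neg) (λ { refl → refl }) (x ≟ y)
pos x ≟ˡ neg y = no λ ()
neg x ≟ˡ pos y = no λ ()

open Subset _≟ˡ_ using (_⊆_; _⊆?_)

_≈?_ : Decidable _≈_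
C ≈? D = map′ fromSubsets toSubsets (C ⊆? D ×-dec D ⊆? C)
  where
  fromSubsets : C ⊆ D × D ⊆ C → C ≈ D
  fromSubsets (C⊆D , D⊆C) l = C⊆D , D⊆C
  toSubsets : C ≈ D → C ⊆ D × D ⊆ C
  toSubsets e = proj₁ (e _) , proj₂ (e _)

clauseDecSetoid : DecSetoid _ _
clauseDecSetoid = record
  { Carrier = Clause
  ; _≈_ = _≈_
  ; isDecEquivalence = record
    { isEquivalence = record { refl = ≈-refl ; sym = ≈-sym ; trans = ≈-trans }
    ; _≟_ = _≈?_ } }

≈-pair⁻ : ∀ {a b c d : Lit} → (a ∷ b ∷ []) ≈ (c ∷ d ∷ []) →
          (a ≡ c × b ≡ d) ⊎ (a ≡ d × b ≡ c)
≈-pair⁻ {a} {b} {c} {d} e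
  with proj₂ (e c) (here refl) | proj₂ (e d) (there (here refl))
     | proj₁ (e a) (here refl) | proj₁ (e b) (there (here refl))
... | here refl         | here refl         | _                 | here refl         = inj₁ (refl , refl)
... | here refl         | here refl         | _                 | there (here refl) = inj₁ (refl , refl)
... | here refl         | there (here refl) | _                 | _                 = inj₁ (refl , refl)
... | there (here refl) | here refl         | _                 | _                 = inj₂ (refl , refl)
... | there (here refl) | there (here refl) | here refl         | _                 = inj₂ (refl , refl)
... | there (here refl) | there (here refl) | there (here refl) | _                 = inj₂ (refl , refl)

≈-pair-swap : ∀ {a b : Lit} → (a ∷ b ∷ []) ≈ (b ∷ a ∷ [])
≈-pair-swap l = swap , swap
  where
  swap : ∀ {x y : Lit} → l ∈ (x ∷ y ∷ []) → l ∈ (y ∷ x ∷ [])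
  swap (here p)         = there (here p)
  swap (there (here p)) = here p

∈-pair⁻ : ∀ {l a b : Lit} → l ∈ (a ∷ b ∷ []) → l ≡ a ⊎ l ≡ b
∈-pair⁻ (here p)         = inj₁ p
∈-pair⁻ (there (here p)) = inj₂ p

_Represents_ : Formula → (Clause → Set) → Set
F Represents P = ∀ C → (C ∈F F → P C) × (P C → C ∈F F)

dedup : Formula → Formula
dedup = deduplicate _≈?_

dedup-distinct : ∀ F → Distinct (dedup F)
dedup-distinct = deduplicate-! clauseDecSetoid

dedup-represents : ∀ {F P} → F Represents P → dedup F Represents P
dedup-represents rep C =
    (λ C∈ → proj₁ (rep C) (deduplicate⁻ _≈?_ C∈))
  , (λ PC → deduplicate⁺ _≈?_ (λ D≈D′ C≈D → ≈-trans C≈D (≈-sym D≈D′)) (proj₂ (rep C) PC))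

module _ {A : Set} where

  singletonIf : Bool → A → List A
  singletonIf b x = if b then [ x ] else []

  module _ {P : A → Set} where

    singletonIf⁻ : ∀ {b x} → Any P (singletonIf b x) → T b × P x
    singletonIf⁻ {true} (here px) = _ , px

    singletonIf⁺ : ∀ {b x} → T b → P x → Any P (singletonIf b x)
    singletonIf⁺ {true} _ px = here px

    concatMap-upTo⁻ : ∀ {f : ℕ → List A} {m} → Any P (concatMap f (upTo m)) →
                      ∃[ i ] (i < m × Any P (f i))
    concatMap-upTo⁻ p with i , i∈ , q ← find (concatMap⁻ _ p) = i , ∈-upTo⁻ i∈ , q

    concatMap-upTo⁺ : ∀ {f : ℕ → List A} {m i} → i < m → Any P (f i) →
                      Any P (concatMap f (upTo m))
    concatMap-upTo⁺ i<m p = concatMap⁺ _ (lose (∈-upTo⁺ i<m) p)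

  length-singletonIf : ∀ b (x : A) → length (singletonIf b x) ≤ 1
  length-singletonIf true  _ = ≤-refl
  length-singletonIf false _ = z≤n

  length-concatMap : ∀ {X : Set} {c} (f : X → List A) xs → (∀ x → length (f x) ≤ c) →
                     length (concatMap f xs) ≤ length xs * c
  length-concatMap f []       _ = z≤n
  length-concatMap f (x ∷ xs) h =
    ≤-trans (≤-reflexive (length-++ (f x))) (+-mono-≤ (h x) (length-concatMap f xs h))

  length-concatMap-upTo : ∀ {c} (f : ℕ → List A) m → (∀ i → length (f i) ≤ c) →
                          length (concatMap f (upTo m)) ≤ m * c
  length-concatMap-upTo f m h =
    subst (λ l → length (concatMap f (upTo m)) ≤ l * _) (length-upTo m) (length-concatMap f (upTo m) h)

  length-concatMap-upTo-singletonIf : ∀ (b : ℕ → Bool) (x : ℕ → A) m →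
                                      length (concatMap (λ i → singletonIf (b i) (x i)) (upTo m)) ≤ m
  length-concatMap-upTo-singletonIf b x m =
    subst (length (concatMap (λ i → singletonIf (b i) (x i)) (upTo m)) ≤_) (*-identityʳ m)
      (length-concatMap-upTo _ m (λ i → length-singletonIf (b i) (x i)))

T-not⁻ : ∀ {b} → T (not b) → ¬ T b
T-not⁻ {false} _ ()

T-not⁺ : ∀ {b} → ¬ T b → T (not b)
T-not⁺ {false} _  = _
T-not⁺ {true}  ¬b = ¬b _

edgeClause : ℕ → ℕ → Clause
edgeClause u v = neg u ∷ neg v ∷ []

∈-pair-var< : ∀ {C a b m} → C ≈ (a ∷ b ∷ []) → var a < m → var b < m →
              ∀ {l} → l ∈ C → var l < m
∈-pair-var< C≈ a<m b<m l∈C with ∈-pair⁻ (proj₁ (C≈ _) l∈C)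
... | inj₁ refl = a<m
... | inj₂ refl = b<m

-- Step t of a schedule introduces the fresh variable y t and uses L = {x̄_u | left t u} and
-- Γ = {x̄_v | right t v}; Reached t is the clause set after steps 0, …, t - 1.
module Schedule (n : ℕ) (adjacent left right : ℕ → ℕ → Bool) where

  covers : ℕ → ℕ → ℕ → Bool
  covers t u v = (left t u ∧ right t v) ∨ (left t v ∧ right t u)

  covers⁻ : ∀ {t u v} → T (covers t u v) →
            (T (left t u) × T (right t v)) ⊎ (T (left t v) × T (right t u))
  covers⁻ c = Sum.map (to T-∧) (to T-∧) (to T-∨ c)

  covers⁺ : ∀ {t u v} → (T (left t u) × T (right t v)) ⊎ (T (left t v) × T (right t u)) →
            T (covers t u v)
  covers⁺ c = from T-∨ (Sum.map (from T-∧) (from T-∧) c)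

  covered : ℕ → ℕ → ℕ → Bool
  covered zero    u v = false
  covered (suc t) u v = covers t u v ∨ covered t u v

  covered-suc : ∀ {t u v} → T (covered t u v) → T (covered (suc t) u v)
  covered-suc = from T-∨ ∘ inj₂

  covered⁻ : ∀ {t u v} → T (covered t u v) → ∃[ i ] (i < t × T (covers i u v))
  covered⁻ {suc t} c with to T-∨ c
  ... | inj₁ now     = t , ≤-refl , now
  ... | inj₂ earlier = let i , i<t , ci = covered⁻ earlier in i , m<n⇒m<1+n i<t , ci

  covered⁺ : ∀ {t i u v} → i < t → T (covers i u v) → T (covered t u v)
  covered⁺ {suc t} i<1+t ci with m<1+n⇒m<n∨m≡n i<1+t
  ... | inj₁ i<t  = from T-∨ (inj₂ (covered⁺ i<t ci))
  ... | inj₂ refl = from T-∨ (inj₁ ci)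

  covered-swap : ∀ {t u v} → T (covered t u v) → T (covered t v u)
  covered-swap {t} {u} {v} c with i , i<t , ci ← covered⁻ {t} {u} {v} c =
    covered⁺ {t} {i} {v} {u} i<t (covers⁺ {i} {v} {u} (Sum.swap (covers⁻ {i} {u} {v} ci)))

  y : ℕ → ℕ
  y t = n + t

  data Reached (t : ℕ) (C : Clause) : Set where
    uncovered-edge : ∀ {u v} → u < n → v < n → T (adjacent u v) → ¬ T (covered t u v) →
                     C ≈ edgeClause u v → Reached t C
    left-link      : ∀ {i u} → i < t → u < n → T (left i u) →
                     C ≈ (neg (y i) ∷ neg u ∷ []) → Reached t C
    right-link     : ∀ {i v} → i < t → v < n → T (right i v) →
                     C ≈ (pos (y i) ∷ neg v ∷ []) → Reached t C

  Reached-var< : ∀ {t C l} → Reached t C → l ∈ C → var l < y t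
  Reached-var< {t} (uncovered-edge u<n v<n _ _ C≈) =
    ∈-pair-var< C≈ (≤-trans u<n (m≤m+n n t)) (≤-trans v<n (m≤m+n n t))
  Reached-var< (left-link i<t u<n _ C≈)  = ∈-pair-var< C≈ (+-monoʳ-< n i<t) (≤-trans u<n (m≤m+n n _))
  Reached-var< (right-link i<t v<n _ C≈) = ∈-pair-var< C≈ (+-monoʳ-< n i<t) (≤-trans v<n (m≤m+n n _))

  Reached-fresh : ∀ {t F} → F Represents Reached t → ¬ Occurs (y t) F
  Reached-fresh rep occ
    with C , C∈F , l∈C ← find occ
    with l , l∈C , eq ← find l∈C
    = <-irrefl eq (Reached-var< (proj₁ (rep C) (Any.map (λ { refl → ≈-refl }) C∈F)) l∈C)

  uncoveredEdges leftLinks rightLinks reached : ℕ → Formula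
  uncoveredEdges t = concatMap (λ u → concatMap (λ v →
    singletonIf (adjacent u v ∧ not (covered t u v)) (edgeClause u v)) (upTo n)) (upTo n)
  leftLinks  t = concatMap (λ i → concatMap (λ u →
    singletonIf (left i u) (neg (y i) ∷ neg u ∷ [])) (upTo n)) (upTo t)
  rightLinks t = concatMap (λ i → concatMap (λ v →
    singletonIf (right i v) (pos (y i) ∷ neg v ∷ [])) (upTo n)) (upTo t)
  reached t = uncoveredEdges t ++ leftLinks t ++ rightLinks t

  reached-represents : ∀ t → reached t Represents Reached t
  reached-represents t C = sound , complete
    where
    sound : C ∈F reached t → Reached t C
    sound C∈ with ++⁻ (uncoveredEdges t) C∈
    ... | inj₁ p
      with u , u<n , p ← concatMap-upTo⁻ p
      with v , v<n , p ← concatMap-upTo⁻ p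
      with b , C≈ ← singletonIf⁻ p
      with A , ¬c ← to T-∧ b
      = uncovered-edge u<n v<n A (T-not⁻ ¬c) C≈
    ... | inj₂ p with ++⁻ (leftLinks t) p
    ... | inj₁ p
      with i , i<t , p ← concatMap-upTo⁻ p
      with u , u<n , p ← concatMap-upTo⁻ p
      with L , C≈ ← singletonIf⁻ p
      = left-link i<t u<n L C≈
    ... | inj₂ p
      with i , i<t , p ← concatMap-upTo⁻ p
      with v , v<n , p ← concatMap-upTo⁻ p
      with R , C≈ ← singletonIf⁻ p
      = right-link i<t v<n R C≈
    complete : Reached t C → C ∈F reached t
    complete (uncovered-edge u<n v<n A ¬c C≈) =
      ++⁺ˡ (concatMap-upTo⁺ u<n (concatMap-upTo⁺ v<n (singletonIf⁺ (from T-∧ (A , T-not⁺ ¬c)) C≈)))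
    complete (left-link i<t u<n L C≈) =
      ++⁺ʳ (uncoveredEdges t) (++⁺ˡ (concatMap-upTo⁺ i<t (concatMap-upTo⁺ u<n (singletonIf⁺ L C≈))))
    complete (right-link i<t v<n R C≈) =
      ++⁺ʳ (uncoveredEdges t)
        (++⁺ʳ (leftLinks t) (concatMap-upTo⁺ i<t (concatMap-upTo⁺ v<n (singletonIf⁺ R C≈))))

  leftLits : ℕ → Clause
  leftLits t = concatMap (λ u → singletonIf (left t u) (neg u)) (upTo n)

  rightUnits : ℕ → List Clause
  rightUnits t = concatMap (λ v → singletonIf (right t v) (neg v ∷ [])) (upTo n)

  leftLits⁻ : ∀ {t ℓ} → ℓ ∈ leftLits t → ∃[ u ] (u < n × T (left t u) × ℓ ≡ neg u)
  leftLits⁻ p with u , u<n , p ← concatMap-upTo⁻ p with L , eq ← singletonIf⁻ p = u , u<n , L , eq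

  leftLits⁺ : ∀ {t u} → u < n → T (left t u) → neg u ∈ leftLits t
  leftLits⁺ u<n L = concatMap-upTo⁺ u<n (singletonIf⁺ L refl)

  rightUnits⁻ : ∀ {t γ} → γ ∈ rightUnits t → ∃[ v ] (v < n × T (right t v) × γ ≡ (neg v ∷ []))
  rightUnits⁻ p with v , v<n , p ← concatMap-upTo⁻ p with R , eq ← singletonIf⁻ p = v , v<n , R , eq

  rightUnits⁺ : ∀ {t v} → v < n → T (right t v) → (neg v ∷ []) ∈ rightUnits t
  rightUnits⁺ v<n R = concatMap-upTo⁺ v<n (singletonIf⁺ R refl)

  leftLits-nonComp : ∀ t → NonComp (leftLits t)
  leftLits-nonComp t x (p , _) with _ , _ , _ , () ← leftLits⁻ p

  rightUnits-nonComp : ∀ t → All NonComp (rightUnits t)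
  rightUnits-nonComp t = All.tabulate λ γ∈ → unit-nonComp (rightUnits⁻ γ∈)
    where
    unit-nonComp : ∀ {γ} → ∃[ v ] (v < n × T (right t v) × γ ≡ (neg v ∷ [])) → NonComp γ
    unit-nonComp (_ , _ , _ , refl) x (here () , _)

  Grid : ℕ → Clause → Set
  Grid t C = C ∈⋈ leftLits t , rightUnits t

  Grid⁻ : ∀ {t C} → Grid t C →
          ∃[ u ] ∃[ v ] (u < n × v < n × T (left t u) × T (right t v) × C ≈ edgeClause u v)
  Grid⁻ (ℓ , γ , ℓ∈ , γ∈ , C≈)
    with u , u<n , L , refl ← leftLits⁻ ℓ∈
    with v , v<n , R , refl ← rightUnits⁻ γ∈
    = u , v , u<n , v<n , L , R , C≈

  Grid-var< : ∀ {t C l} → Grid t C → l ∈ C → var l < n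
  Grid-var< g with _ , _ , u<n , v<n , _ , _ , C≈ ← Grid⁻ g = ∈-pair-var< C≈ u<n v<n

  link-not-Grid : ∀ {t C i a b} → C ≈ (a ∷ b ∷ []) → var a ≡ y i → ¬ Grid t C
  link-not-Grid {i = i} C≈ a≡yi g =
    m+n≮m n i (subst (_< n) a≡yi (Grid-var< g (proj₂ (C≈ _) (here refl))))

  module _ (biclique : ∀ {t u v} → T (left t u) → T (right t v) → T (adjacent u v))
           (covered-once : ∀ {t i u v} → T (left t u) → T (right t v) → T (covers i u v) → i ≡ t)
           where

    module Step {t F F′} (rF : F Represents Reached t) (rF′ : F′ Represents Reached (suc t)) where

      -- The local Rhs of BVAStep, instantiated to this step.
      BVAResult : Clause → Set
      BVAResult C = (C ∈F F × ¬ Grid t C)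
               ⊎ (∃[ ℓ ] (ℓ ∈ leftLits t × C ≈ (neg (y t) ∷ ℓ ∷ [])))
               ⊎ (∃[ γ ] (γ ∈ rightUnits t × C ≈ (pos (y t) ∷ γ)))

      kept : ∀ {C} → Reached t C → C ∈F F
      kept = proj₂ (rF _)

      result⁺ : ∀ {C} → Reached (suc t) C → BVAResult C
      result⁺ (uncovered-edge u<n v<n A ¬c C≈) =
        inj₁ (kept (uncovered-edge u<n v<n A (¬c ∘ covered-suc) C≈) , not-Grid)
        where
        not-Grid : ¬ Grid t _
        not-Grid g with _ , _ , _ , _ , L , R , C≈′ ← Grid⁻ g
                   with ≈-pair⁻ (≈-trans (≈-sym C≈) C≈′)
        ... | inj₁ (refl , refl) = ¬c (covered⁺ ≤-refl (covers⁺ (inj₁ (L , R))))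
        ... | inj₂ (refl , refl) = ¬c (covered⁺ ≤-refl (covers⁺ (inj₂ (L , R))))
      result⁺ (left-link i<1+t u<n L C≈) with m<1+n⇒m<n∨m≡n i<1+t
      ... | inj₁ i<t  = inj₁ (kept (left-link i<t u<n L C≈) , link-not-Grid C≈ refl)
      ... | inj₂ refl = inj₂ (inj₁ (neg _ , leftLits⁺ u<n L , C≈))
      result⁺ (right-link i<1+t v<n R C≈) with m<1+n⇒m<n∨m≡n i<1+t
      ... | inj₁ i<t  = inj₁ (kept (right-link i<t v<n R C≈) , link-not-Grid C≈ refl)
      ... | inj₂ refl = inj₂ (inj₂ (neg _ ∷ [] , rightUnits⁺ v<n R , C≈))

      result⁻ : ∀ {C} → BVAResult C → Reached (suc t) C
      result⁻ (inj₁ (C∈F , ¬g)) with proj₁ (rF _) C∈F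
      ... | uncovered-edge u<n v<n A ¬c C≈ = uncovered-edge u<n v<n A ¬c′ C≈
        where
        ¬c′ : ¬ T (covered (suc t) _ _)
        ¬c′ c with to T-∨ c
        ... | inj₂ earlier = ¬c earlier
        ... | inj₁ now with covers⁻ now
        ... | inj₁ (L , R) = ¬g (_ , _ , leftLits⁺ u<n L , rightUnits⁺ v<n R , C≈)
        ... | inj₂ (L , R) = ¬g (_ , _ , leftLits⁺ v<n L , rightUnits⁺ u<n R , ≈-trans C≈ ≈-pair-swap)
      ... | left-link i<t u<n L C≈  = left-link (m<n⇒m<1+n i<t) u<n L C≈
      ... | right-link i<t v<n R C≈ = right-link (m<n⇒m<1+n i<t) v<n R C≈
      result⁻ (inj₂ (inj₁ (ℓ , ℓ∈ , C≈))) with u , u<n , L , refl ← leftLits⁻ ℓ∈ =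
        left-link ≤-refl u<n L C≈
      result⁻ (inj₂ (inj₂ (γ , γ∈ , C≈))) with v , v<n , R , refl ← rightUnits⁻ γ∈ =
        right-link ≤-refl v<n R C≈

      grid⊆F : ∀ ℓ γ → ℓ ∈ leftLits t → γ ∈ rightUnits t → (ℓ ∷ γ) ∈F F
      grid⊆F _ _ ℓ∈ γ∈
        with u , u<n , L , refl ← leftLits⁻ ℓ∈
        with v , v<n , R , refl ← rightUnits⁻ γ∈
        = kept (uncovered-edge u<n v<n (biclique L R) not-covered ≈-refl)
        where
        not-covered : ¬ T (covered t u v)
        not-covered c with i , i<t , ci ← covered⁻ c = <-irrefl (covered-once L R ci) i<t

      bva-step : BVAStep F F′
      bva-step = leftLits t , rightUnits t , y t , leftLits-nonComp t , rightUnits-nonComp t , Reached-fresh rF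
               , grid⊆F , λ C → (result⁺ ∘ proj₁ (rF′ C)) , (proj₂ (rF′ C) ∘ result⁻)

    bva-run : ∀ {t F Z} → 0 < t → F Represents Reached 0 → Z Represents Reached t → F ⇝BVA Z
    bva-run {suc zero}    _ rF rZ = Step.bva-step rF rZ ◅ ε
    bva-run {suc (suc t)} _ rF rZ = bva-run (s≤s z≤n) rF rₜ ◅◅ Step.bva-step rₜ rZ ◅ ε
      where
      rₜ = reached-represents (suc t)

module _ {n} (G : Graph n) where

  open Graph G using (adj)

  adjacentℕ : ℕ → ℕ → Bool
  adjacentℕ u v with u <? n | v <? n
  ... | yes u<n | yes v<n = adj (fromℕ< u<n) (fromℕ< v<n)
  ... | _       | _       = false

  adjacentℕ-toℕ : ∀ a b → adjacentℕ (toℕ a) (toℕ b) ≡ adj a b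
  adjacentℕ-toℕ a b with toℕ a <? n | toℕ b <? n
  ... | yes p | yes q = cong₂ adj (fromℕ<-toℕ a p) (fromℕ<-toℕ b q)
  ... | yes _ | no ¬q = contradiction (toℕ<n b) ¬q
  ... | no ¬p | _     = contradiction (toℕ<n a) ¬p

  adjacentℕ⁻ : ∀ {u v} → T (adjacentℕ u v) → ∃[ a ] ∃[ b ] (toℕ a ≡ u × toℕ b ≡ v × T (adj a b))
  adjacentℕ⁻ {u} {v} A with u <? n | v <? n
  ... | yes p | yes q = fromℕ< p , fromℕ< q , toℕ-fromℕ< p , toℕ-fromℕ< q , A

  adjacentℕ-range : ∀ {u v} → T (adjacentℕ u v) → u < n × v < n
  adjacentℕ-range A with a , b , refl , refl , _ ← adjacentℕ⁻ A = toℕ<n a , toℕ<n b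

  adjacentℕ-sym : ∀ {u v} → T (adjacentℕ u v) → T (adjacentℕ v u)
  adjacentℕ-sym A with a , b , refl , refl , ab ← adjacentℕ⁻ A =
    subst T (trans (Graph.sym G a b) (sym (adjacentℕ-toℕ b a))) ab

  edgeFormula-represents : ∀ left right →
                           edgeFormula G Represents Schedule.Reached n adjacentℕ left right 0
  edgeFormula-represents left right C = sound , complete
    where
    open Schedule n adjacentℕ left right
    row : Fin n → Formula
    row a = concatMap (λ b → singletonIf (adj a b) (edgeClause (toℕ a) (toℕ b))) (allFin n)
    sound : C ∈F edgeFormula G → Reached 0 C
    sound C∈
      with a , _ , C∈ ← find (concatMap⁻ row {xs = allFin n} C∈)
      with b , _ , C∈ ← find (concatMap⁻ _ {xs = allFin n} C∈)
      with ab , C≈ ← singletonIf⁻ C∈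
      = uncovered-edge (toℕ<n a) (toℕ<n b) (subst T (sym (adjacentℕ-toℕ a b)) ab) (λ ()) C≈
    complete : Reached 0 C → C ∈F edgeFormula G
    complete (uncovered-edge _ _ A _ C≈) with a , b , refl , refl , ab ← adjacentℕ⁻ A =
      concatMap⁺ _ (lose (∈-allFin a) (concatMap⁺ _ (lose (∈-allFin b) (singletonIf⁺ ab C≈))))

odd : ℕ → Bool
odd zero          = false
odd (suc zero)    = true
odd (suc (suc m)) = odd m

bitCons : Bool → ℕ → ℕ
bitCons false e = e + e
bitCons true  e = suc (e + e)

odd-bitCons : ∀ b e → odd (bitCons b e) ≡ b
odd-bitCons false zero    = refl
odd-bitCons true  zero    = refl
odd-bitCons false (suc e) rewrite +-suc e e = odd-bitCons false e
odd-bitCons true  (suc e) rewrite +-suc e e = odd-bitCons true e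

⌊bitCons/2⌋ : ∀ b e → ⌊ bitCons b e /2⌋ ≡ e
⌊bitCons/2⌋ false e = sym (n≡⌊n+n/2⌋ e)
⌊bitCons/2⌋ true  e = sym (n≡⌈n+n/2⌉ e)

bitCons-< : ∀ b {e p} → e < p → bitCons b e < 2 * p
bitCons-< b {e} {p} e<p = begin-strict
  bitCons b e     ≤⟨ bitCons≤ b ⟩
  suc (e + e)     <⟨ +-monoʳ-< 1 (+-monoʳ-< e ≤-refl) ⟩
  suc e + suc e   ≤⟨ +-mono-≤ e<p (≤-trans e<p (m≤m+n p 0)) ⟩
  2 * p           ∎
  where
  open ≤-Reasoning
  bitCons≤ : ∀ b → bitCons b e ≤ suc (e + e)
  bitCons≤ false = n≤1+n _
  bitCons≤ true  = ≤-refl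

encode : ℕ → (ℕ → Bool) → ℕ
encode zero    f = 0
encode (suc m) f = bitCons (f 0) (encode m (λ i → f (suc i)))

testBit : ℕ → ℕ → Bool
testBit s zero    = odd s
testBit s (suc i) = testBit ⌊ s /2⌋ i

testBit-encode : ∀ m f {i} → i < m → testBit (encode m f) i ≡ f i
testBit-encode (suc m) f {zero}  _         = odd-bitCons (f 0) _
testBit-encode (suc m) f {suc i} (s≤s i<m) =
  trans (cong (λ s → testBit s i) (⌊bitCons/2⌋ (f 0) _)) (testBit-encode m (λ i → f (suc i)) i<m)

encode-< : ∀ m f → encode m f < 2 ^ m
encode-< zero    f = s≤s z≤n
encode-< (suc m) f = bitCons-< (f 0) (encode-< m (λ i → f (suc i)))

module _ (d : ℕ) .{{_ : NonZero d}} where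

  open ≤-Reasoning

  m≡[m/d]*d+m%d : ∀ m → m ≡ m / d * d + m % d
  m≡[m/d]*d+m%d m = trans (m≡m%n+[m/n]*n m d) (+-comm (m % d) _)

  [j*d+r]/d≡j : ∀ j {r} → r < d → (j * d + r) / d ≡ j
  [j*d+r]/d≡j j {r} r<d = begin-equality
    (j * d + r) / d         ≡⟨ cong (_/ d) (+-comm (j * d) r) ⟩
    (r + j * d) / d         ≡⟨ +-distrib-/ r (j * d) no-carry ⟩
    r / d + j * d / d       ≡⟨ cong₂ _+_ (m<n⇒m/n≡0 r<d) (m*n/n≡m j d) ⟩
    j                       ∎
    where
    no-carry : r % d + j * d % d < d
    no-carry = subst (_< d) (sym (trans (cong₂ _+_ (m<n⇒m%n≡m r<d) (m*n%n≡0 j d)) (+-identityʳ r))) r<d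

  [j*d+r]%d≡r : ∀ j {r} → r < d → (j * d + r) % d ≡ r
  [j*d+r]%d≡r j {r} r<d =
    trans (cong (_% d) (+-comm (j * d) r)) (trans ([m+kn]%n≡m%n r j d) (m<n⇒m%n≡m r<d))

  j*d+r<m*d : ∀ {j r m} → j < m → r < d → j * d + r < m * d
  j*d+r<m*d {j} {r} {m} j<m r<d = begin-strict
    j * d + r   <⟨ +-monoʳ-< (j * d) r<d ⟩
    j * d + d   ≡⟨ +-comm (j * d) d ⟩
    suc j * d   ≤⟨ *-monoˡ-≤ d j<m ⟩
    m * d       ∎

module BlockSchedule (n k : ℕ) .{{_ : NonZero k}} (adjacent : ℕ → ℕ → Bool)
  (adjacent-sym : ∀ {u v} → T (adjacent u v) → T (adjacent v u))
  (adjacent-range : ∀ {u v} → T (adjacent u v) → u < n × v < n)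
  where

  K : ℕ
  K = 2 ^ k

  instance
    K-nonZero : NonZero K
    K-nonZero = m^n≢0 2 k

  blocks : ℕ
  blocks = suc (n / k)

  block offset : ℕ → ℕ
  block  u = u / k
  offset u = u % k

  vertex : ℕ → ℕ → ℕ
  vertex j i = j * k + i

  code : ℕ → ℕ → ℕ
  code u j = encode k (λ i → adjacent u (vertex j i))

  step : ℕ → ℕ → ℕ
  step j s = j * K + s

  steps : ℕ
  steps = blocks * K

  -- Step j K + s handles block j and the vertices of earlier blocks whose neighbourhood in
  -- block j has bit vector s.
  left right : ℕ → ℕ → Bool
  left  t u = (block u <ᵇ t / K) ∧ (code u (t / K) ≡ᵇ t % K)
  right t v = (block v ≡ᵇ t / K) ∧ testBit (t % K) (offset v)

  open Schedule n adjacent left right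

  block<blocks : ∀ {v} → v < n → block v < blocks
  block<blocks v<n = s≤s (/-monoˡ-≤ k (<⇒≤ v<n))

  vertex-block-offset : ∀ v → vertex (block v) (offset v) ≡ v
  vertex-block-offset v = sym (m≡[m/d]*d+m%d k v)

  block-vertex : ∀ j {i} → i < k → block (vertex j i) ≡ j
  block-vertex j = [j*d+r]/d≡j k j

  offset-vertex : ∀ j {i} → i < k → offset (vertex j i) ≡ i
  offset-vertex j = [j*d+r]%d≡r k j

  step-decode : ∀ t → step (t / K) (t % K) ≡ t
  step-decode t = sym (m≡[m/d]*d+m%d K t)

  step<steps : ∀ {j s} → j < blocks → s < K → step j s < steps
  step<steps = j*d+r<m*d K

  code<K : ∀ u j → code u j < K
  code<K u j = encode-< k (λ i → adjacent u (vertex j i))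

  testBit-code : ∀ u j {i} → i < k → testBit (code u j) i ≡ adjacent u (vertex j i)
  testBit-code u j = testBit-encode k (λ i → adjacent u (vertex j i))

  left⁻ : ∀ {t u} → T (left t u) → block u < t / K × code u (t / K) ≡ t % K
  left⁻ {t} {u} L with b<j , c≡s ← to T-∧ L =
    <ᵇ⇒< (block u) (t / K) b<j , ≡ᵇ⇒≡ (code u (t / K)) (t % K) c≡s

  right⁻ : ∀ {t v} → T (right t v) → block v ≡ t / K × T (testBit (t % K) (offset v))
  right⁻ {t} {v} R with b≡j , bit ← to T-∧ R = ≡ᵇ⇒≡ (block v) (t / K) b≡j , bit

  left-step : ∀ {u j} → block u < j → T (left (step j (code u j)) u)
  left-step {u} {j} b<j = from T-∧ (<⇒<ᵇ (subst (block u <_) (sym j≡) b<j) , ≡⇒≡ᵇ _ _ p≡)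
    where
    j≡ : step j (code u j) / K ≡ j
    j≡ = [j*d+r]/d≡j K j (code<K u j)
    p≡ : code u (step j (code u j) / K) ≡ step j (code u j) % K
    p≡ = trans (cong (code u) j≡) (sym ([j*d+r]%d≡r K j (code<K u j)))

  right-step : ∀ {j s i} → s < K → i < k → T (testBit s i) → T (right (step j s) (vertex j i))
  right-step {j} {s} {i} s<K i<k bit = from T-∧
    ( ≡⇒≡ᵇ _ _ (trans (block-vertex j i<k) (sym ([j*d+r]/d≡j K j s<K)))
    , subst T (sym (cong₂ testBit ([j*d+r]%d≡r K j s<K) (offset-vertex j i<k))) bit )

  biclique : ∀ {t u v} → T (left t u) → T (right t v) → T (adjacent u v)
  biclique {t} {u} {v} L R with _ , c≡s ← left⁻ L with b≡j , bit ← right⁻ R =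
    subst T (sym bit≡) bit
    where
    open ≡-Reasoning
    bit≡ : adjacent u v ≡ testBit (t % K) (offset v)
    bit≡ = begin
      adjacent u v                                ≡⟨ cong (adjacent u) (sym (vertex-block-offset v)) ⟩
      adjacent u (vertex (block v) (offset v))    ≡⟨ cong (λ j → adjacent u (vertex j (offset v))) b≡j ⟩
      adjacent u (vertex (t / K) (offset v))      ≡⟨ sym (testBit-code u (t / K) (m%n<n v k)) ⟩
      testBit (code u (t / K)) (offset v)         ≡⟨ cong (λ s → testBit s (offset v)) c≡s ⟩
      testBit (t % K) (offset v)                  ∎

  covered-once : ∀ {t i u v} → T (left t u) → T (right t v) → T (covers i u v) → i ≡ t
  covered-once {t} {i} {u} {v} L R c with covers⁻ c
  ... | inj₁ (L′ , R′) = begin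
      i                      ≡⟨ sym (step-decode i) ⟩
      step (i / K) (i % K)   ≡⟨ cong₂ step i/K≡t/K i%K≡t%K ⟩
      step (t / K) (t % K)   ≡⟨ step-decode t ⟩
      t                      ∎
    where
    open ≡-Reasoning
    i/K≡t/K : i / K ≡ t / K
    i/K≡t/K = trans (sym (proj₁ (right⁻ R′))) (proj₁ (right⁻ R))
    i%K≡t%K : i % K ≡ t % K
    i%K≡t%K = trans (sym (proj₂ (left⁻ L′))) (trans (cong (code u) i/K≡t/K) (proj₂ (left⁻ L)))
  ... | inj₂ (L′ , R′) = contradiction (subst (block v <_) j≡ (proj₁ (left⁻ L′))) (<-asym bu<bv)
    where
    j≡ : i / K ≡ block u
    j≡ = sym (proj₁ (right⁻ R′))
    bu<bv : block u < block v
    bu<bv = subst (block u <_) (sym (proj₁ (right⁻ R))) (proj₁ (left⁻ L))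

  same-block-uncovered : ∀ {t u v} → block u ≡ block v → ¬ T (covered t u v)
  same-block-uncovered {t} {u} {v} bu≡bv c
    with i , _ , ci ← covered⁻ {t} {u} {v} c
    with covers⁻ {i} {u} {v} ci
  ... | inj₁ (L , R) = <-irrefl (trans bu≡bv (proj₁ (right⁻ R))) (proj₁ (left⁻ L))
  ... | inj₂ (L , R) = <-irrefl (trans (sym bu≡bv) (proj₁ (right⁻ R))) (proj₁ (left⁻ L))

  cross-block-covered : ∀ {u v} → block u < block v → T (adjacent u v) → T (covered steps u v)
  cross-block-covered {u} {v} bu<bv A = covered⁺ t<steps (covers⁺ (inj₁ (left-step bu<bv , R)))
    where
    c<K = code<K u (block v)
    t<steps = step<steps (block<blocks (proj₂ (adjacent-range A))) c<K
    R : T (right (step (block v) (code u (block v))) v)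
    R = subst (λ w → T (right (step (block v) (code u (block v))) w)) (vertex-block-offset v)
          (right-step {block v} c<K (m%n<n v k)
            (subst T (sym (trans (testBit-code u (block v) (m%n<n v k))
                                 (cong (adjacent u) (vertex-block-offset v)))) A))

  uncovered⇒same-block : ∀ {u v} → T (adjacent u v) → ¬ T (covered steps u v) → block u ≡ block v
  uncovered⇒same-block {u} {v} A ¬c with <-cmp (block u) (block v)
  ... | tri< bu<bv _ _ = contradiction (cross-block-covered bu<bv A) ¬c
  ... | tri≈ _ bu≡bv _ = bu≡bv
  ... | tri> _ _ bv<bu =
    contradiction (covered-swap {steps} {v} {u} (cross-block-covered bv<bu (adjacent-sym A))) ¬c

  -- An enumeration of Reached steps in which every link ȳ ∨ x̄_u occurs once: for each block j,
  -- u is on the left of step j K + code u j only.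
  innerRow leftLinksOf : ℕ → Formula
  innerRow u = concatMap (λ i →
    singletonIf (adjacent u (vertex (block u) i)) (edgeClause u (vertex (block u) i))) (upTo k)
  leftLinksOf j = concatMap (λ u →
    singletonIf (block u <ᵇ j) (neg (y (step j (code u j))) ∷ neg u ∷ [])) (upTo n)

  rightLinksOf : ℕ → ℕ → Formula
  rightLinksOf j s = concatMap (λ i →
    singletonIf ((vertex j i <ᵇ n) ∧ testBit s i) (pos (y (step j s)) ∷ neg (vertex j i) ∷ [])) (upTo k)

  innerEdges leftLinksByBlock rightLinksByBlock compressed : Formula
  innerEdges        = concatMap innerRow (upTo n)
  leftLinksByBlock  = concatMap leftLinksOf (upTo blocks)
  rightLinksByBlock = concatMap (λ j → concatMap (rightLinksOf j) (upTo K)) (upTo blocks)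
  compressed        = innerEdges ++ leftLinksByBlock ++ rightLinksByBlock

  compressed-sound : ∀ {C} → C ∈F compressed → Reached steps C
  compressed-sound C∈ with ++⁻ innerEdges C∈
  ... | inj₁ p
    with u , u<n , p ← concatMap-upTo⁻ p
    with i , i<k , p ← concatMap-upTo⁻ p
    with A , C≈ ← singletonIf⁻ p
    = uncovered-edge u<n (proj₂ (adjacent-range A)) A
        (same-block-uncovered {steps} (sym (block-vertex (block u) i<k))) C≈
  ... | inj₂ p with ++⁻ leftLinksByBlock p
  ... | inj₁ p
    with j , j<blocks , p ← concatMap-upTo⁻ p
    with u , u<n , p ← concatMap-upTo⁻ p
    with bu<j , C≈ ← singletonIf⁻ p
    = left-link (step<steps j<blocks (code<K u j)) u<n (left-step {u} {j} (<ᵇ⇒< _ _ bu<j)) C≈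
  ... | inj₂ p
    with j , j<blocks , p ← concatMap-upTo⁻ p
    with s , s<K , p ← concatMap-upTo⁻ p
    with i , i<k , p ← concatMap-upTo⁻ p
    with b , C≈ ← singletonIf⁻ p
    with v<n , bit ← to T-∧ b
    = right-link (step<steps j<blocks s<K) (<ᵇ⇒< _ _ v<n) (right-step {j} s<K i<k bit) C≈

  compressed-complete : ∀ {C} → Reached steps C → C ∈F compressed
  compressed-complete (uncovered-edge {u} {v} u<n v<n A ¬c C≈) =
    inner u<n (m%n<n v k) v≡ A C≈
    where
    v≡ : vertex (block u) (offset v) ≡ v
    v≡ = trans (cong (λ j → vertex j (offset v)) (uncovered⇒same-block A ¬c)) (vertex-block-offset v)
    inner : ∀ {u i v C} → u < n → i < k → vertex (block u) i ≡ v → T (adjacent u v) →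
            C ≈ edgeClause u v → C ∈F compressed
    inner u<n i<k refl A C≈ =
      ++⁺ˡ (concatMap-upTo⁺ {f = innerRow} u<n (concatMap-upTo⁺ i<k (singletonIf⁺ A C≈)))
  compressed-complete (left-link {t} {u} t<steps u<n L C≈) =
    link (m<n*o⇒m/o<n {n = blocks} {o = K} t<steps) u<n (proj₁ (left⁻ L)) t≡ C≈
    where
    t≡ : step (t / K) (code u (t / K)) ≡ t
    t≡ = trans (cong (step (t / K)) (proj₂ (left⁻ L))) (step-decode t)
    link : ∀ {j u t C} → j < blocks → u < n → block u < j → step j (code u j) ≡ t →
           C ≈ (neg (y t) ∷ neg u ∷ []) → C ∈F compressed
    link j<blocks u<n bu<j refl C≈ = ++⁺ʳ innerEdges (++⁺ˡ
      (concatMap-upTo⁺ {f = leftLinksOf} j<blocks (concatMap-upTo⁺ u<n (singletonIf⁺ (<⇒<ᵇ bu<j) C≈))))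
  compressed-complete (right-link {t} {v} t<steps v<n R C≈) =
    link (m<n*o⇒m/o<n {n = blocks} {o = K} t<steps) (m%n<n t K) (m%n<n v k) (step-decode t) v≡ v<n
         (proj₂ (right⁻ R)) C≈
    where
    v≡ : vertex (t / K) (offset v) ≡ v
    v≡ = trans (cong (λ j → vertex j (offset v)) (sym (proj₁ (right⁻ R)))) (vertex-block-offset v)
    link : ∀ {j s i t v C} → j < blocks → s < K → i < k → step j s ≡ t → vertex j i ≡ v → v < n →
           T (testBit s i) → C ≈ (pos (y t) ∷ neg v ∷ []) → C ∈F compressed
    link {j} j<blocks s<K i<k refl refl v<n bit C≈ = ++⁺ʳ innerEdges (++⁺ʳ leftLinksByBlock
      (concatMap-upTo⁺ j<blocks (concatMap-upTo⁺ {f = rightLinksOf j} s<K (concatMap-upTo⁺ i<k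
        (singletonIf⁺ (from T-∧ (<⇒<ᵇ v<n , bit)) C≈)))))

  compressed-represents : compressed Represents Reached steps
  compressed-represents C = compressed-sound , compressed-complete

  length-compressed : length compressed ≤ n * k + (blocks * n + blocks * (K * k))
  length-compressed = begin
    length compressed
      ≡⟨ length-++ innerEdges ⟩
    length innerEdges + length (leftLinksByBlock ++ rightLinksByBlock)
      ≡⟨ cong (length innerEdges +_) (length-++ leftLinksByBlock) ⟩
    length innerEdges + (length leftLinksByBlock + length rightLinksByBlock)
      ≤⟨ +-mono-≤ inner (+-mono-≤ byBlockˡ byBlockʳ) ⟩
    n * k + (blocks * n + blocks * (K * k)) ∎
    where
    open ≤-Reasoning
    inner = length-concatMap-upTo innerRow n (λ u → length-concatMap-upTo-singletonIf _ _ k)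
    byBlockˡ = length-concatMap-upTo leftLinksOf blocks (λ j → length-concatMap-upTo-singletonIf _ _ n)
    byBlockʳ = length-concatMap-upTo (λ j → concatMap (rightLinksOf j) (upTo K)) blocks (λ j →
                 length-concatMap-upTo (rightLinksOf j) K (λ s → length-concatMap-upTo-singletonIf _ _ k))

bva-compress : ∀ {n} (G : Graph n) k .{{_ : NonZero k}} →
               ∃[ F ] (edgeFormula G ⇝BVA F × Distinct F
                       × length F ≤ n * k + (suc (n / k) * n + suc (n / k) * (2 ^ k * k)))
bva-compress {n} G k =
    dedup compressed
  , bva-run biclique covered-once steps>0
            (edgeFormula-represents G left right) (dedup-represents compressed-represents)
  , dedup-distinct compressed
  , ≤-trans (length-deduplicate _ compressed) length-compressed
  where
  open BlockSchedule n k (adjacentℕ G) (adjacentℕ-sym G) (adjacentℕ-range G)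
  open Schedule n (adjacentℕ G) left right
  steps>0 : 0 < steps
  steps>0 = >-nonZero⁻¹ steps {{m*n≢0 blocks K}}

m<2^m : ∀ m → m < 2 ^ m
m<2^m zero    = s≤s z≤n
m<2^m (suc m) = begin-strict
  suc m             ≤⟨ m<2^m m ⟩
  2 ^ m             <⟨ m<m+n (2 ^ m) (m^n>0 2 m) ⟩
  2 ^ m + 2 ^ m     ≡⟨ cong (2 ^ m +_) (sym (+-identityʳ (2 ^ m))) ⟩
  2 ^ suc m         ∎
  where open ≤-Reasoning

2*⌊n/2⌋≤n : ∀ n → 2 * ⌊ n /2⌋ ≤ n
2*⌊n/2⌋≤n n = begin
  2 * ⌊ n /2⌋             ≡⟨ cong (⌊ n /2⌋ +_) (+-identityʳ ⌊ n /2⌋) ⟩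
  ⌊ n /2⌋ + ⌊ n /2⌋       ≤⟨ +-monoʳ-≤ ⌊ n /2⌋ (⌊n/2⌋≤⌈n/2⌉ n) ⟩
  ⌊ n /2⌋ + ⌈ n /2⌉       ≡⟨ ⌊n/2⌋+⌈n/2⌉≡n n ⟩
  n                       ∎
  where open ≤-Reasoning

2^⌊log₂n⌋≤n : ∀ {n} → 1 ≤ n → 2 ^ ⌊log₂ n ⌋ ≤ n
2^⌊log₂n⌋≤n (s≤s {n = n} _) = <-rec (λ n → 2 ^ ⌊log₂ suc n ⌋ ≤ suc n) bound n
  where
  open ≤-Reasoning
  bound : ∀ n → (∀ {m} → m < n → 2 ^ ⌊log₂ suc m ⌋ ≤ suc m) → 2 ^ ⌊log₂ suc n ⌋ ≤ suc n
  bound zero    _   = subst (λ e → 2 ^ e ≤ 1) (sym (⌊log₂[2^n]⌋≡n 0)) ≤-refl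
  bound (suc m) rec = begin
    2 ^ ⌊log₂ 2 + m ⌋                       ≡⟨ cong (2 ^_) (sym (m+[n∸m]≡n 1≤log)) ⟩
    2 * 2 ^ (⌊log₂ 2 + m ⌋ ∸ 1)
      ≡⟨ cong (λ e → 2 * 2 ^ e) (sym (⌊log₂⌊n/2⌋⌋≡⌊log₂n⌋∸1 (2 + m))) ⟩
    2 * 2 ^ ⌊log₂ suc ⌊ m /2⌋ ⌋             ≤⟨ *-monoʳ-≤ 2 (rec (s≤s (⌊n/2⌋≤n m))) ⟩
    2 * suc ⌊ m /2⌋                         ≤⟨ 2*⌊n/2⌋≤n (2 + m) ⟩
    2 + m                                   ∎
    where
    1≤log : 1 ≤ ⌊log₂ 2 + m ⌋
    1≤log = subst (_≤ ⌊log₂ 2 + m ⌋) (⌊log₂[2^n]⌋≡n 1) (⌊log₂⌋-mono-≤ {2} {2 + m} (s≤s (s≤s z≤n)))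

L≤2*suc⌊L/2⌋ : ∀ L → L ≤ 2 * suc ⌊ L /2⌋
L≤2*suc⌊L/2⌋ L = begin
  L                                 ≡⟨ sym (⌊n/2⌋+⌈n/2⌉≡n L) ⟩
  ⌊ L /2⌋ + ⌈ L /2⌉                 ≤⟨ +-mono-≤ (n≤1+n _) (⌊n/2⌋-mono (n≤1+n (suc L))) ⟩
  suc ⌊ L /2⌋ + suc ⌊ L /2⌋         ≡⟨ cong (suc ⌊ L /2⌋ +_) (sym (+-identityʳ _)) ⟩
  2 * suc ⌊ L /2⌋                   ∎
  where open ≤-Reasoning

2*suc⌊L/2⌋≤L+2 : ∀ L → 2 * suc ⌊ L /2⌋ ≤ L + 2
2*suc⌊L/2⌋≤L+2 L = begin
  2 * suc ⌊ L /2⌋                   ≡⟨ *-suc 2 ⌊ L /2⌋ ⟩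
  2 + 2 * ⌊ L /2⌋                   ≤⟨ +-monoʳ-≤ 2 (2*⌊n/2⌋≤n L) ⟩
  2 + L                             ≡⟨ +-comm 2 L ⟩
  L + 2                             ∎
  where open ≤-Reasoning

size-bound : ∀ {n k L} .{{_ : NonZero k}} → 2 ^ L ≤ n → L ≤ 2 * k → 2 * k ≤ L + 2 →
             (n * k + (suc (n / k) * n + suc (n / k) * (2 ^ k * k))) * L ≤ 51 * n ^ 2
size-bound {n} {k} {L} 2^L≤n L≤2k 2k≤L+2 = begin
  (n * k + (suc q * n + suc q * (K * k))) * L
    ≡⟨ expand n k q K L ⟩
  n * (k * L) + (n * L + n * (q * L)) + (k + q * k) * (K * L)
    ≤⟨ +-mono-≤ (+-mono-≤ (*-monoʳ-≤ n (·L≤8n k≤K))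
                          (+-mono-≤ (*-monoʳ-≤ n L≤n) (*-monoʳ-≤ n qL≤2n)))
                (*-mono-≤ k+qk≤5n (·L≤8n ≤-refl)) ⟩
  n * (8 * n) + (n * n + n * (2 * n)) + 5 * n * (8 * n)
    ≡⟨ collect n ⟩
  51 * n ^ 2 ∎
  where
  open ≤-Reasoning
  q = n / k
  K = 2 ^ k
  instance
    K-nonZero : NonZero K
    K-nonZero = m^n≢0 2 k
  expand : ∀ n k q K L → (n * k + ((1 + q) * n + (1 + q) * (K * k))) * L
                       ≡ n * (k * L) + (n * L + n * (q * L)) + (k + q * k) * (K * L)
  expand = solve-∀
  collect : ∀ n → n * (8 * n) + (n * n + n * (2 * n)) + 5 * n * (8 * n) ≡ 51 * (n * (n * 1))
  collect = solve-∀
  K*K≤4n : K * K ≤ 4 * n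
  K*K≤4n = begin
    K * K           ≡⟨ sym (^-distribˡ-+-* 2 k k) ⟩
    2 ^ (k + k)     ≤⟨ ^-monoʳ-≤ 2 (subst (_≤ L + 2) (cong (k +_) (+-identityʳ k)) 2k≤L+2) ⟩
    2 ^ (L + 2)     ≡⟨ ^-distribˡ-+-* 2 L 2 ⟩
    2 ^ L * 4       ≤⟨ *-monoˡ-≤ 4 2^L≤n ⟩
    n * 4           ≡⟨ *-comm n 4 ⟩
    4 * n           ∎
  k≤K : k ≤ K
  k≤K = <⇒≤ (m<2^m k)
  ·L≤8n : ∀ {x} → x ≤ K → x * L ≤ 8 * n
  ·L≤8n {x} x≤K = begin
    x * L           ≤⟨ *-mono-≤ x≤K (≤-trans L≤2k (*-monoʳ-≤ 2 k≤K)) ⟩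
    K * (2 * K)     ≡⟨ trans (*-comm K (2 * K)) (*-assoc 2 K K) ⟩
    2 * (K * K)     ≤⟨ *-monoʳ-≤ 2 K*K≤4n ⟩
    2 * (4 * n)     ≡⟨ sym (*-assoc 2 4 n) ⟩
    8 * n           ∎
  L≤n : L ≤ n
  L≤n = ≤-trans (<⇒≤ (m<2^m L)) 2^L≤n
  qL≤2n : q * L ≤ 2 * n
  qL≤2n = begin
    q * L           ≤⟨ *-monoʳ-≤ q L≤2k ⟩
    q * (2 * k)     ≡⟨ trans (*-comm q (2 * k)) (trans (*-assoc 2 k q) (cong (2 *_) (*-comm k q))) ⟩
    2 * (q * k)     ≤⟨ *-monoʳ-≤ 2 (m/n*n≤m n k) ⟩
    2 * n           ∎
  k+qk≤5n : k + q * k ≤ 5 * n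
  k+qk≤5n = subst (_≤ 5 * n) (+-comm (q * k) k) (+-mono-≤ (m/n*n≤m n k) k≤4n)
    where
    k≤4n : k ≤ 4 * n
    k≤4n = ≤-trans k≤K (≤-trans (m≤m*n K K) K*K≤4n)

proposition14 : ∃[ c ] (∀ n → 2 ≤ n → (G : Graph n) →
                  ∃[ F ] (edgeFormula G ⇝BVA F × Distinct F
                          × length F * ⌊log₂ n ⌋ ≤ c * n ^ 2))
proposition14 = 51 , λ n 2≤n G →
  let L = ⌊log₂ n ⌋
      F , run , distinct , |F|≤ = bva-compress G (suc ⌊ L /2⌋)
  in  F , run , distinct
    , ≤-trans (*-monoˡ-≤ L |F|≤)
              (size-bound (2^⌊log₂n⌋≤n (≤-trans (n≤1+n 1) 2≤n))
                          (L≤2*suc⌊L/2⌋ L) (2*suc⌊L/2⌋≤L+2 L))
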